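{- Let $\mathbf{Q}$ be a non-flat QB-algebra (i.e. $1\neq 0$). Then: (1) if $\mathscr{R}(Q)$ is finite, then $|\mathscr{R}(Q)|$ is even and there are regular elements $x_1,\dots,x_k$ with $x_i\neq x_j$ and $x_i\neq x_j^{*}$ for $i\neq j$ such that $Q=cl(x_1)\sqcup\cdots\sqcup cl(x_k)\sqcup cl(x_1^{*})\sqcup\cdots\sqcup cl(x_k^{*})$, where $\sqcup$ denotes disjoint union; (2) if $Q$ is finite, then $|Q|$ is even.
   Context: A quasi-lattice is an algebra $\langle L;\vee,\wedge\rangle$ such that for all $x,y,z$: $\vee,\wedge$ are commutative and associative; $x\vee(x\wedge y)=x\vee x$ and $x\wedge(x\vee y)=x\wedge x$; $x\vee(y\vee y)=x\vee y$ and $x\wedge(y\wedge y)=x\wedge y$; $x\vee x=x\wedge x$; distributive if both distributive laws hold. A QB-algebra is an algebra $\langle Q;\vee,\wedge,{}^{*},0,1\rangle$ of type $\langle 2,2,1,0,0\rangle$ such that $\langle Q;\vee,\wedge\rangle$ is a distributive quasi-lattice and for all $x$: $x\vee 1=1$, $x\wedge 0=0$, $x\vee x^{*}=1$, $x\wedge x^{*}=0$, $(x\wedge x)^{*}=x^{*}\vee x^{*}$, $x^{**}=x$. A QB-algebra is flat if $1=0$. An element $x$ is regular if $x\vee x=x$; $\mathscr{R}(Q)$ denotes the set of regular elements. For a regular element $x$, $cl(x)=\{y\in Q: y\vee y=x\vee x\}$ (the cloud of $x$). -}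

module Defs where

open import Level using (Level; suc)
open import Data.Nat using (ℕ; _*_)
open import Data.Fin using (Fin)
open import Data.Sum using (_⊎_; inj₁; inj₂)
open import Data.Product using (Σ; ∃; ∃-syntax; _×_; _,_)
open import Data.List using (List; length)
open import Data.List.Membership.Propositional using (_∈_)
open import Data.List.Relation.Unary.All using (All)
open import Data.List.Relation.Unary.Unique.Propositional using (Unique)
open import Relation.Binary.PropositionalEquality using (_≡_; _≢_)
open import Relation.Nullary using (¬_)

record QBAlgebra (a : Level) : Set (suc a) where
  infixr 6 _∨_
  infixr 7 _∧_
  field
    Q   : Set a
    _∨_ : Q → Q → Q
    _∧_ : Q → Q → Q
    _*  : Q → Q
    𝟘   : Q
    𝟙   : Q
    ∨-comm  : ∀ x y → x ∨ y ≡ y ∨ x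
    ∧-comm  : ∀ x y → x ∧ y ≡ y ∧ x
    ∨-assoc : ∀ x y z → (x ∨ y) ∨ z ≡ x ∨ (y ∨ z)
    ∧-assoc : ∀ x y z → (x ∧ y) ∧ z ≡ x ∧ (y ∧ z)
    ∨-absorb : ∀ x y → x ∨ (x ∧ y) ≡ x ∨ x
    ∧-absorb : ∀ x y → x ∧ (x ∨ y) ≡ x ∧ x
    ∨-idem : ∀ x y → x ∨ (y ∨ y) ≡ x ∨ y
    ∧-idem : ∀ x y → x ∧ (y ∧ y) ≡ x ∧ y
    ∨∧-same : ∀ x → x ∨ x ≡ x ∧ x
    ∧-distrib-∨ : ∀ x y z → x ∧ (y ∨ z) ≡ (x ∧ y) ∨ (x ∧ z)
    ∨-distrib-∧ : ∀ x y z → x ∨ (y ∧ z) ≡ (x ∨ y) ∧ (x ∨ z)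
    ∨-top : ∀ x → x ∨ 𝟙 ≡ 𝟙
    ∧-bot : ∀ x → x ∧ 𝟘 ≡ 𝟘
    ∨-compl : ∀ x → x ∨ (x *) ≡ 𝟙
    ∧-compl : ∀ x → x ∧ (x *) ≡ 𝟘
    *-∧ : ∀ x → (x ∧ x) * ≡ (x *) ∨ (x *)
    *-invol : ∀ x → (x *) * ≡ x

module _ {a : Level} (A : QBAlgebra a) where
  open QBAlgebra A

  Flat : Set a
  Flat = 𝟙 ≡ 𝟘

  Regular : Q → Set a
  Regular x = x ∨ x ≡ x

  -- y ∈ cl(x)  (used for regular x)
  InCloud : Q → Q → Set a
  InCloud y x = y ∨ y ≡ x ∨ x

  -- l is a duplicate-free list of exactly the regular elements (so R(Q) is finite, |R(Q)| = length l)
  EnumeratesRegular : List Q → Set a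
  EnumeratesRegular l = Unique l × All Regular l × (∀ x → Regular x → x ∈ l)

  -- l is a duplicate-free list of all elements (so Q is finite, |Q| = length l)
  EnumeratesAll : List Q → Set a
  EnumeratesAll l = Unique l × (∀ x → x ∈ l)

  doubled : {k : ℕ} → (Fin k → Q) → Fin k ⊎ Fin k → Q
  doubled x (inj₁ i) = x i
  doubled x (inj₂ i) = (x i) *

  CloudDecomposition : (k : ℕ) → (Fin k → Q) → Set a
  CloudDecomposition k x =
    (∀ i → Regular (x i)) ×
    (∀ i j → i ≢ j → x i ≢ x j) ×
    (∀ i j → i ≢ j → x i ≢ (x j) *) ×
    (∀ y → ∃[ c ] InCloud y (doubled x c)) ×
    (∀ y c d → InCloud y (doubled x c) → InCloud y (doubled x d) → c ≡ d)

Even : ℕ → Set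
Even n = ∃[ m ] n ≡ 2 * m

-- In a non-flat algebra x ↦ x* is an involution without fixed points: if y* = y then the regular
-- element x = y ∨ y is fixed too, as (y ∨ y)* = (y ∧ y)* = y* ∨ y*, and then
-- 1 = x ∨ x* = x ∨ x = x ∧ x = x ∧ x* = 0. Since * also preserves regularity, Q and ℛ(Q) both split
-- into two-element orbits {x, x*}; a transversal r of the orbits exhibits the set as a permutation of
-- r ++ map _* r, hence of even size. For regular z, y ∈ cl(z) just says y ∨ y = z, so every y lies in
-- the cloud of exactly one regular element, namely y ∨ y.
module Submission where

open import Defs
open import Level using (Level)
open import Data.Nat using (_+_; _*_; _<_; s≤s)
open import Data.Nat.Induction using (<-wellFounded)
open import Data.Nat.Properties using (+-identityʳ; n≤1+n)
open import Data.Fin using (Fin; zero; suc)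
open import Data.Product using (Σ; ∃-syntax; _×_; _,_)
open import Data.Sum using (inj₁; inj₂)
open import Data.Sum.Properties using (inj₁-injective)
open import Data.List using (List; []; _∷_; _++_; [_]; map; length; lookup)
open import Data.List.Properties using (length-++; length-map)
open import Data.List.Membership.Propositional using (_∈_; _∉_)
open import Data.List.Membership.Propositional.Properties
  using (∈-lookup; ∈-∃++; ∈-++⁺ʳ; ∈-++⁻; ∈-map⁺; ∈-map⁻)
open import Data.List.Relation.Unary.Any using (here; there; index)
open import Data.List.Relation.Unary.Any.Properties using (lookup-index)
import Data.List.Relation.Unary.All as All
import Data.List.Relation.Unary.All.Properties as All
open import Data.List.Relation.Unary.AllPairs using ([]; _∷_)
open import Data.List.Relation.Unary.Unique.Propositional using (Unique)
open import Data.List.Relation.Unary.Unique.Propositional.Properties using (Unique[x∷xs]⇒x∉xs)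
open import Data.List.Relation.Binary.Disjoint.Propositional using (Disjoint)
open import Data.List.Relation.Binary.Permutation.Propositional
  using (_↭_; ↭-refl; ↭-sym; ↭-trans; ↭-prep; ↭⇒↭ₛ′)
open import Data.List.Relation.Binary.Permutation.Propositional.Properties
  using (∈-resp-↭; All-resp-↭; ↭-length; shift)
import Data.List.Relation.Binary.Permutation.Setoid.Properties as Permutationₛ
open import Data.Empty using (⊥-elim)
open import Function using (_∘_)
open import Induction.WellFounded using (Acc; acc)
open import Relation.Nullary using (¬_)
open import Relation.Binary.PropositionalEquality
  using (_≡_; _≢_; refl; sym; trans; cong; subst; setoid; isEquivalence; module ≡-Reasoning)

module _ {b} {B : Set b} where

  Unique-resp-↭ : ∀ {xs ys : List B} → xs ↭ ys → Unique xs → Unique ys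
  Unique-resp-↭ = Permutationₛ.Unique-resp-↭ (setoid B) ∘ ↭⇒↭ₛ′ isEquivalence

  Unique-++⁻ : ∀ (xs : List B) {ys} → Unique (xs ++ ys) → Unique xs × Disjoint xs ys
  Unique-++⁻ []       _           = [] , λ ()
  Unique-++⁻ (x ∷ xs) (x∉ ∷ uxs) with uxs′ , disjoint ← Unique-++⁻ xs uxs =
    All.++⁻ˡ xs x∉ ∷ uxs′ , λ where
      (here refl , v∈ys) → All.lookup x∉ (∈-++⁺ʳ xs v∈ys) refl
      (there v∈xs , v∈ys) → disjoint (v∈xs , v∈ys)

  Unique⇒lookup-injective : ∀ {xs : List B} → Unique xs →
                            ∀ i j → lookup xs i ≡ lookup xs j → i ≡ j
  Unique⇒lookup-injective (_ ∷ _)   zero    zero    _ = refl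
  Unique⇒lookup-injective (x∉ ∷ _)  zero    (suc j) e = ⊥-elim (All.lookup x∉ (∈-lookup j) e)
  Unique⇒lookup-injective (x∉ ∷ _)  (suc i) zero    e = ⊥-elim (All.lookup x∉ (∈-lookup i) (sym e))
  Unique⇒lookup-injective (_ ∷ u)   (suc i) (suc j) e = cong suc (Unique⇒lookup-injective u i j e)

  ↭-∷∷-longer : ∀ {xs : List B} {x y ys} → xs ↭ x ∷ y ∷ ys → length ys < length xs
  ↭-∷∷-longer {ys = ys} σ = subst (length ys <_) (sym (↭-length σ)) (s≤s (n≤1+n _))

  length-++-map : ∀ (f : B → B) xs → length (xs ++ map f xs) ≡ 2 * length xs
  length-++-map f xs = begin
    length (xs ++ map f xs)          ≡⟨ length-++ xs ⟩
    length xs + length (map f xs)    ≡⟨ cong (length xs +_) (length-map f xs) ⟩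
    length xs + length xs            ≡⟨ cong (length xs +_) (sym (+-identityʳ (length xs))) ⟩
    2 * length xs                    ∎
    where open ≡-Reasoning

  ↭-++-map⇒Even : ∀ (f : B → B) r {l} → l ↭ r ++ map f r → Even (length l)
  ↭-++-map⇒Even f r σ = length r , trans (↭-length σ) (length-++-map f r)

  involutive⇒injective : ∀ (f : B → B) → (∀ x → f (f x) ≡ x) → ∀ {x y} → f x ≡ f y → x ≡ y
  involutive⇒injective f f-involutive {x} {y} e =
    trans (sym (f-involutive x)) (trans (cong f e) (f-involutive y))

Closed : ∀ {b} {B : Set b} → (B → B) → List B → Set b
Closed f l = ∀ {x} → x ∈ l → f x ∈ l

module _ {b} {B : Set b} (f : B → B)
         (f-involutive : ∀ x → f (f x) ≡ x) (f-fixpoint-free : ∀ x → f x ≢ x) where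

  private
    f-injective : ∀ {x y} → f x ≡ f y → x ≡ y
    f-injective = involutive⇒injective f f-involutive

  f-head∈tail : ∀ {x t} → Closed f (x ∷ t) → f x ∈ t
  f-head∈tail {x} closed with closed (here refl)
  ... | here fx≡x  = ⊥-elim (f-fixpoint-free x fx≡x)
  ... | there fx∈t = fx∈t

  peel-orbit : ∀ {x t} → Unique (x ∷ t) → Closed f (x ∷ t) →
               ∃[ t′ ] (x ∷ t ↭ x ∷ f x ∷ t′) × Closed f t′
  peel-orbit {x} u closed with ys , zs , refl ← ∈-∃++ (f-head∈tail closed) =
    ys ++ zs , σ , closed′
    where
    σ : x ∷ ys ++ [ f x ] ++ zs ↭ x ∷ f x ∷ ys ++ zs
    σ = ↭-prep x (shift (f x) ys zs)

    x∉ : x ∉ f x ∷ ys ++ zs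
    x∉ = Unique[x∷xs]⇒x∉xs (Unique-resp-↭ σ u)

    fx∉ : f x ∉ ys ++ zs
    fx∉ with _ ∷ u′ ← Unique-resp-↭ σ u = Unique[x∷xs]⇒x∉xs u′

    closed′ : Closed f (ys ++ zs)
    closed′ w∈ with ∈-resp-↭ σ (closed (∈-resp-↭ (↭-sym σ) (there (there w∈))))
    ... | here fw≡x          = ⊥-elim (fx∉ (subst (_∈ ys ++ zs) w≡fx w∈))
      where w≡fx = f-injective (trans fw≡x (sym (f-involutive x)))
    ... | there (here fw≡fx) = ⊥-elim (x∉ (there (subst (_∈ ys ++ zs) (f-injective fw≡fx) w∈)))
    ... | there (there fw∈)  = fw∈

  transversal : ∀ l → Unique l → Closed f l → ∃[ r ] l ↭ r ++ map f r
  transversal l = go l (<-wellFounded (length l))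
    where
    go : ∀ l → Acc _<_ (length l) → Unique l → Closed f l → ∃[ r ] l ↭ r ++ map f r
    go []      _         _ _      = [] , ↭-refl
    go (x ∷ t) (acc rec) u closed
      with t′ , σ , closed′ ← peel-orbit u closed
      with _ ∷ _ ∷ u′ ← Unique-resp-↭ σ u
      with r , τ ← go t′ (rec (↭-∷∷-longer σ)) u′ closed′ =
      x ∷ r , ↭-trans σ (↭-prep x (↭-trans (↭-prep (f x) τ) (↭-sym (shift (f x) r (map f r)))))

module QBAlgebraProperties {a : Level} (A : QBAlgebra a) where
  open QBAlgebra A
  open ≡-Reasoning

  ∨-self-regular : ∀ y → Regular A (y ∨ y)
  ∨-self-regular y = begin
    (y ∨ y) ∨ (y ∨ y) ≡⟨ ∨-idem (y ∨ y) y ⟩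
    (y ∨ y) ∨ y       ≡⟨ ∨-comm (y ∨ y) y ⟩
    y ∨ (y ∨ y)       ≡⟨ ∨-idem y y ⟩
    y ∨ y             ∎

  *-regular : ∀ {x} → Regular A x → Regular A (x *)
  *-regular {x} x-reg = begin
    x * ∨ x *   ≡⟨ *-∧ x ⟨
    (x ∧ x) *   ≡⟨ cong _* (∨∧-same x) ⟨
    (x ∨ x) *   ≡⟨ cong _* x-reg ⟩
    x *         ∎

  *-injective : ∀ {x y} → x * ≡ y * → x ≡ y
  *-injective = involutive⇒injective _* *-invol

  regular-*-fixed⇒flat : ∀ {x} → Regular A x → x * ≡ x → Flat A
  regular-*-fixed⇒flat {x} x-reg x*≡x = begin
    𝟙        ≡⟨ ∨-compl x ⟨
    x ∨ x *  ≡⟨ cong (x ∨_) x*≡x ⟩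
    x ∨ x    ≡⟨ ∨∧-same x ⟩
    x ∧ x    ≡⟨ cong (x ∧_) x*≡x ⟨
    x ∧ x *  ≡⟨ ∧-compl x ⟩
    𝟘        ∎

  *-fixed⇒flat : ∀ {y} → y * ≡ y → Flat A
  *-fixed⇒flat {y} y*≡y = regular-*-fixed⇒flat (∨-self-regular y) (begin
    (y ∨ y) *  ≡⟨ cong _* (∨∧-same y) ⟩
    (y ∧ y) *  ≡⟨ *-∧ y ⟩
    y * ∨ y *  ≡⟨ cong (λ z → z ∨ z) y*≡y ⟩
    y ∨ y      ∎)

  doubled-bijective⇒CloudDecomposition : ∀ {k} (x : Fin k → Q) →
    (∀ c → Regular A (doubled A x c)) →
    (∀ {c d} → doubled A x c ≡ doubled A x d → c ≡ d) →
    (∀ z → Regular A z → ∃[ c ] z ≡ doubled A x c) →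
    CloudDecomposition A k x
  doubled-bijective⇒CloudDecomposition x regular injective onto =
    (λ i → regular (inj₁ i)) ,
    (λ i j i≢j → i≢j ∘ inj₁-injective ∘ injective) ,
    (λ i j _ → inj₁≢inj₂ ∘ injective) ,
    cover ,
    unique
    where
    inj₁≢inj₂ : ∀ {k} {i j : Fin k} → inj₁ i ≢ inj₂ j
    inj₁≢inj₂ ()

    cover : ∀ y → ∃[ c ] InCloud A y (doubled A x c)
    cover y with c , e ← onto (y ∨ y) (∨-self-regular y) = c , trans e (sym (regular c))

    unique : ∀ y c d → InCloud A y (doubled A x c) → InCloud A y (doubled A x d) → c ≡ d
    unique y c d y∈c y∈d = injective (begin
      doubled A x c                    ≡⟨ regular c ⟨
      doubled A x c ∨ doubled A x c    ≡⟨ y∈c ⟨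
      y ∨ y                            ≡⟨ y∈d ⟩
      doubled A x d ∨ doubled A x d    ≡⟨ regular d ⟩
      doubled A x d                    ∎)

  module _ (nonflat : ¬ Flat A) where

    *-fixpoint-free : ∀ y → y * ≢ y
    *-fixpoint-free y = nonflat ∘ *-fixed⇒flat

    *-transversal : ∀ l → Unique l → Closed _* l → ∃[ r ] l ↭ r ++ map _* r
    *-transversal = transversal _* *-invol *-fixpoint-free

    EnumeratesAll⇒Even : ∀ l → EnumeratesAll A l → Even (length l)
    EnumeratesAll⇒Even l (u , complete)
      with r , σ ← *-transversal l u (λ {x} _ → complete (x *)) =
      ↭-++-map⇒Even _* r σ

    EnumeratesRegular⇒decomposition : ∀ l → EnumeratesRegular A l →
      Even (length l) × (∃[ k ] Σ (Fin k → Q) (CloudDecomposition A k))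
    EnumeratesRegular⇒decomposition l (u , all-regular , complete)
      with r , σ ← *-transversal l u (λ x∈l → complete _ (*-regular (All.lookup all-regular x∈l)))
      with ur , disjoint ← Unique-++⁻ r (Unique-resp-↭ σ u) =
      ↭-++-map⇒Even _* r σ ,
      length r , lookup r ,
      doubled-bijective⇒CloudDecomposition (lookup r) doubled-regular doubled-injective onto
      where
      r-regular : ∀ i → Regular A (lookup r i)
      r-regular i = All.lookup (All.++⁻ˡ r (All-resp-↭ σ all-regular)) (∈-lookup i)

      doubled-regular : ∀ c → Regular A (doubled A (lookup r) c)
      doubled-regular (inj₁ i) = r-regular i
      doubled-regular (inj₂ i) = *-regular (r-regular i)

      r≢r* : ∀ i j → lookup r i ≢ lookup r j *
      r≢r* i j e =
        disjoint (∈-lookup i , subst (_∈ map _* r) (sym e) (∈-map⁺ _* (∈-lookup j)))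

      doubled-injective : ∀ {c d} → doubled A (lookup r) c ≡ doubled A (lookup r) d → c ≡ d
      doubled-injective {inj₁ i} {inj₁ j} e = cong inj₁ (Unique⇒lookup-injective ur i j e)
      doubled-injective {inj₁ i} {inj₂ j} e = ⊥-elim (r≢r* i j e)
      doubled-injective {inj₂ i} {inj₁ j} e = ⊥-elim (r≢r* j i (sym e))
      doubled-injective {inj₂ i} {inj₂ j} e =
        cong inj₂ (Unique⇒lookup-injective ur i j (*-injective e))

      onto : ∀ z → Regular A z → ∃[ c ] z ≡ doubled A (lookup r) c
      onto z z-reg with ∈-++⁻ r (∈-resp-↭ σ (complete z z-reg))
      ... | inj₁ z∈r = inj₁ (index z∈r) , lookup-index z∈r
      ... | inj₂ z∈r* with y , y∈r , refl ← ∈-map⁻ _* z∈r* =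
        inj₂ (index y∈r) , cong _* (lookup-index y∈r)

proposition3p9 : {a : Level} (A : QBAlgebra a) → ¬ Flat A →
    ((l : List (QBAlgebra.Q A)) → EnumeratesRegular A l →
      Even (length l) × (∃[ k ] Σ (Fin k → QBAlgebra.Q A) (λ x → CloudDecomposition A k x)))
    × ((l : List (QBAlgebra.Q A)) → EnumeratesAll A l → Even (length l))
proposition3p9 A nonflat = EnumeratesRegular⇒decomposition nonflat , EnumeratesAll⇒Even nonflat
  where open QBAlgebraProperties A
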